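{- Let $n,m\ge1$. The function $u_{n,m}(\nu)$ on $\mathcal P_n(m)$ is symmetric, i.e. invariant under every permutation of $\nu_1,\dots,\nu_n$. Moreover, if $n\ge m$, then for every $\nu=(\nu_1,\dots,\nu_n)\in\mathcal P_n(m)$ with $\nu_{m+1}=\cdots=\nu_n=0$, $$u_{n,m}(\nu)=\frac{(n-\ell(\nu))!}{(m-\ell(\nu))!}\,u_{m,m}(\nu_1,\dots,\nu_m).$$
   Context: $\mathcal P_n(m)$ is the set of $\nu=(\nu_1,\dots,\nu_n)\in\mathbb{Z}_{\ge0}^n$ with $\nu_1+\cdots+\nu_n=m$, and $\ell(\nu)$ is the number of positive entries of $\nu$. $\zeta_m$ is a fixed primitive $m$-th root of unity. For $\nu\in\mathcal P_n(m)$ let $S_{n,m}(\nu)$ be the set of permutations $\sigma\in S_n$ such that $\sigma(i)\in\{1,\dots,m\}$ for every $i$ with $\nu_i\ge1$, and $u_{n,m}(\nu)=\sum_{\sigma\in S_{n,m}(\nu)}\zeta_m^{\sigma(1)\nu_1+\cdots+\sigma(n)\nu_n}$. -}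

module Defs where

open import Level using (Level)
open import Data.Nat using (ℕ; zero; suc; _+_; _*_; _<_; _≤_; _≟_; _<?_; _≤?_)
open import Data.Fin using (Fin; toℕ) renaming (zero to fz; suc to fs)
import Data.Fin as Fin
open import Data.Fin.Properties using (all?; any?)
open import Data.List using (allFin; List; []; _∷_; [_]; map; concatMap; filter; foldr; length)
open import Data.Product using (_×_; ∃)
open import Relation.Nullary using (Dec; ¬_)
open import Relation.Nullary.Decidable using (_×-dec_; _→-dec_; ¬?)
open import Relation.Binary.PropositionalEquality using (_≡_)
open import Algebra.Bundles using (CommutativeRing; Semiring)

Σℕ : (n : ℕ) → (Fin n → ℕ) → ℕ
Σℕ zero    f = 0
Σℕ (suc n) f = f fz + Σℕ n (λ i → f (fs i))

InP : (n m : ℕ) → (Fin n → ℕ) → Set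
InP n m ν = Σℕ n ν ≡ m

ℓ : (n : ℕ) → (Fin n → ℕ) → ℕ
ℓ zero    ν = 0
ℓ (suc n) ν with ν fz
... | zero  = ℓ n (λ i → ν (fs i))
... | suc _ = suc (ℓ n (λ i → ν (fs i)))

cons : ∀ {n k} → Fin k → (Fin n → Fin k) → Fin (suc n) → Fin k
cons a f fz     = a
cons a f (fs i) = f i

allFuns : (n k : ℕ) → List (Fin n → Fin k)
allFuns zero    k = [ (λ ()) ]
allFuns (suc n) k = concatMap (λ f → map (λ a → cons a f) (allFin k)) (allFuns n k)

IsPerm : (n : ℕ) → (Fin n → Fin n) → Set
IsPerm n σ = (∀ i j → σ i ≡ σ j → i ≡ j) × (∀ y → ∃ λ x → σ x ≡ y)

isPerm? : (n : ℕ) → (σ : Fin n → Fin n) → Dec (IsPerm n σ)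
isPerm? n σ =
  all? (λ i → all? (λ j → (σ i Fin.≟ σ j) →-dec (i Fin.≟ j)))
  ×-dec all? (λ y → any? (λ x → σ x Fin.≟ y))

-- Positions are 0-indexed: Fin n element i stands for i+1 ∈ {1,…,n}.
-- Condition for σ ∈ S_{n,m}(ν): σ(i) ∈ {1,…,m} whenever ν_i ≥ 1,
-- i.e. toℕ (σ i) + 1 ≤ m.
Cond : (n m : ℕ) → (Fin n → ℕ) → (Fin n → Fin n) → Set
Cond n m ν σ = ∀ i → 1 ≤ ν i → suc (toℕ (σ i)) ≤ m

cond? : (n m : ℕ) → (ν : Fin n → ℕ) → (σ : Fin n → Fin n) → Dec (Cond n m ν σ)
cond? n m ν σ = all? (λ i → (1 ≤? ν i) →-dec (suc (toℕ (σ i)) ≤? m))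

InS : (n m : ℕ) → (Fin n → ℕ) → (Fin n → Fin n) → Set
InS n m ν σ = IsPerm n σ × Cond n m ν σ

inS? : (n m : ℕ) → (ν : Fin n → ℕ) → (σ : Fin n → Fin n) → Dec (InS n m ν σ)
inS? n m ν σ = isPerm? n σ ×-dec cond? n m ν σ

Slist : (n m : ℕ) → (Fin n → ℕ) → List (Fin n → Fin n)
Slist n m ν = filter (inS? n m ν) (allFuns n n)

expo : (n : ℕ) → (Fin n → ℕ) → (Fin n → Fin n) → ℕ
expo n ν σ = Σℕ n (λ i → suc (toℕ (σ i)) * ν i)

module _ {c ℓ' : Level} (R : CommutativeRing c ℓ') where
  open CommutativeRing R using (Carrier; _≈_; 1#; 0#; semiring) renaming (_+_ to _⊕_)
  open import Algebra.Definitions.RawSemiring (Semiring.rawSemiring semiring) using (_^_) renaming (_×_ to _×ₙ_)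

  IsPrimitiveRoot : ℕ → Carrier → Set ℓ'
  IsPrimitiveRoot m ζ = (ζ ^ m ≈ 1#) × (∀ k → 0 < k → k < m → ¬ (ζ ^ k ≈ 1#))

  u : (ζ : Carrier) (n m : ℕ) → (Fin n → ℕ) → Carrier
  u ζ n m ν = foldr (λ σ acc → ζ ^ expo n ν σ ⊕ acc) 0# (Slist n m ν)

  nsmul : ℕ → Carrier → Carrier
  nsmul k x = k ×ₙ x

module Submission where

-- Both assertions are proved by reindexing the sum u_{n,m}(ν) = Σ_{σ ∈ S_{n,m}(ν)} ζ^{Σ σ(i)νᵢ}
-- along a bijection; no property of ζ is used.
--
-- Symmetry.  σ ↦ σ ∘ π⁻¹ is a bijection S_{n,m}(ν ∘ π) ≅ S_{n,m}(ν) preserving the exponent.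
--
-- If m ≤ n and ν_{n+1} = 0, then (σ′, q) ↦ (σ′ extended by n+1 ↦ n+1) ∘ (q n+1) is a
-- bijection from S_{n,m}(ν₁,…,νₙ) × {q : ν_q = 0} onto S_{n+1,m}(ν) preserving the exponent, so
-- u_{n+1,m}(ν) = (n + 1 - ℓ(ν)) · u_{n,m}(ν₁,…,νₙ).  Iterating from n down to m gives the factor
-- (n - ℓ)!/(m - ℓ)!.

open import Defs
open import Level using (Level)
open import Data.Nat using (ℕ; _≤_; _/_; _!; _∸_)
open import Data.Nat.Properties using (_!≢0)
open import Data.Fin using (Fin; toℕ; inject≤)
open import Data.Fin.Permutation using (Permutation′; _⟨$⟩ʳ_)
open import Data.Product using (_×_)
open import Relation.Binary.PropositionalEquality using (_≡_)
open import Algebra.Bundles using (CommutativeRing)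

open import Level using (_⊔_; 0ℓ)
open import Function using (_∘_)
open import Data.Nat using (zero; suc; _+_; _*_; _<_; s≤s; z≤n; _≤′_; ≤′-refl; ≤′-step) renaming (_≟_ to _≟ℕ_)
open import Data.Nat.Properties
  using (*-zeroʳ; +-identityʳ; +-suc; m≤n+m; m+n∸n≡m; +-∸-assoc; ∸-monoˡ-≤; ≤′⇒≤; ≤⇒≤′; <⇒≱; +-0-commutativeMonoid)
open import Data.Nat.DivMod using (n/n≡1; *-/-assoc)
open import Data.Nat.Divisibility using (m≤n⇒m!∣n!)
import Algebra.Properties.CommutativeMonoid.Sum +-0-commutativeMonoid as ℕSum
import Data.Fin as Fin
open import Data.Fin using (fromℕ; inject₁; lower₁)
open import Data.Fin.Properties
  using (≡-decSetoid; all?; suc-injective; toℕ-injective; toℕ-fromℕ; toℕ-inject₁; toℕ-inject₁-≢; toℕ-inject≤;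
         inject≤-refl; lower₁-inject₁′; inject₁-lower₁; inject₁-injective; fromℕ≢inject₁)
  renaming (_≟_ to _≟ᶠ_)
open import Data.Fin.Permutation using (_⟨$⟩ˡ_; inverseˡ; inverseʳ; flip; transpose)
import Data.Fin.Permutation.Components as PC
open import Data.List using (List; []; _∷_; _++_; map; filter; foldr; length; concatMap; cartesianProduct; allFin)
open import Data.List.Properties using (filter-++; length-++; filter-≐; filter-none; map-tabulate)
open import Data.List.Relation.Unary.All as All using (All; []; _∷_)
open import Data.List.Relation.Unary.All.Properties using (all-filter; map⁺; concat⁺)
open import Data.Product using (_,_; proj₁; proj₂; ∃)
open import Data.Product.Relation.Binary.Pointwise.NonDependent using (×-decSetoid)
open import Data.Sum using (_⊎_; inj₁; inj₂)
open import Relation.Nullary using (Dec; yes; no; ¬_; contradiction)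
open import Relation.Unary using (Pred; Decidable; U)
open import Relation.Binary.Bundles using (Setoid; DecSetoid)
open import Relation.Binary.PropositionalEquality
  using (_≢_; refl; sym; trans; cong; cong₂; subst; _≗_; _→-setoid_; module ≡-Reasoning)
open import Algebra.Bundles using (CommutativeMonoid; Semiring)

count : ∀ {a p} {A : Set a} {P : Pred A p} → Decidable P → List A → ℕ
count P? L = length (filter P? L)

module _ {a p q} {A : Set a} {P : Pred A p} {Q : Pred A q} (P? : Decidable P) (Q? : Decidable Q) where

  filter-congᴬ : ∀ {L} → All (λ x → (P x → Q x) × (Q x → P x)) L → filter P? L ≡ filter Q? L
  filter-congᴬ {[]} [] = refl
  filter-congᴬ {x ∷ L} ((P⇒Q , Q⇒P) ∷ agree) with P? x | Q? x
  ... | yes _  | yes _  = cong (x ∷_) (filter-congᴬ agree)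
  ... | no _   | no _   = filter-congᴬ agree
  ... | yes Px | no ¬Qx = contradiction (P⇒Q Px) ¬Qx
  ... | no ¬Px | yes Qx = contradiction (Q⇒P Qx) ¬Px

  filter-absorb : (∀ {x} → P x → Q x) → ∀ L → filter P? (filter Q? L) ≡ filter P? L
  filter-absorb P⇒Q [] = refl
  filter-absorb P⇒Q (x ∷ L) with Q? x
  ... | yes _ with P? x
  ...   | yes _ = cong (x ∷_) (filter-absorb P⇒Q L)
  ...   | no _  = filter-absorb P⇒Q L
  filter-absorb P⇒Q (x ∷ L) | no ¬Qx with P? x
  ...   | yes Px = contradiction (P⇒Q Px) ¬Qx
  ...   | no _   = filter-absorb P⇒Q L

count-map : ∀ {a b p} {A : Set a} {B : Set b} {P : Pred B p} (P? : Decidable P) (f : A → B) L →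
  count P? (map f L) ≡ count (P? ∘ f) L
count-map P? f [] = refl
count-map P? f (x ∷ L) with P? (f x)
... | yes _ = cong suc (count-map P? f L)
... | no _  = count-map P? f L

count-concatMap : ∀ {a b p q} {A : Set a} {B : Set b} {P : Pred B p} {Q : Pred A q}
  (P? : Decidable P) (Q? : Decidable Q) (g : A → List B) →
  (∀ {x} → Q x → count P? (g x) ≡ 1) → (∀ {x} → ¬ Q x → count P? (g x) ≡ 0) →
  ∀ L → count P? (concatMap g L) ≡ count Q? L
count-concatMap P? Q? g one none [] = refl
count-concatMap P? Q? g one none (x ∷ L) = begin
  count P? (g x ++ concatMap g L)                 ≡⟨ cong length (filter-++ P? (g x) (concatMap g L)) ⟩
  length (filter P? (g x) ++ filter P? (concatMap g L)) ≡⟨ length-++ (filter P? (g x)) ⟩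
  count P? (g x) + count P? (concatMap g L)       ≡⟨ cong (count P? (g x) +_) (count-concatMap P? Q? g one none L) ⟩
  count P? (g x) + count Q? L                     ≡⟨ block ⟩
  count Q? (x ∷ L)                                ∎
  where
  open ≡-Reasoning
  block : count P? (g x) + count Q? L ≡ count Q? (x ∷ L)
  block with Q? x
  ... | yes Qx = cong (_+ count Q? L) (one Qx)
  ... | no ¬Qx = cong (_+ count Q? L) (none ¬Qx)

cartesianProduct-rows : ∀ {a b} {A : Set a} {B : Set b} (L : List A) (L′ : List B) →
  cartesianProduct L L′ ≡ concatMap (λ x → map (x ,_) L′) L
cartesianProduct-rows [] L′ = refl
cartesianProduct-rows (x ∷ L) L′ = cong (map (x ,_) L′ ++_) (cartesianProduct-rows L L′)

module ListSum {c ℓ} (M : CommutativeMonoid c ℓ) where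

  open CommutativeMonoid M renaming (_∙_ to _+ᴹ_; ε to 0ᴹ; refl to ≈-refl; sym to ≈-sym; trans to ≈-trans)
  open import Algebra.Properties.CommutativeMonoid.Mult M using (×-homo-1; ×-distrib-+) renaming (_×_ to _·_) public
  open import Algebra.Properties.CommutativeSemigroup commutativeSemigroup using (interchange)
  open import Relation.Binary.Reasoning.Setoid setoid

  sumList : ∀ {a} {A : Set a} → List A → (A → Carrier) → Carrier
  sumList L f = foldr (λ x acc → f x +ᴹ acc) 0ᴹ L

  syntax sumList L (λ x → e) = ∑[ x ∈ L ] e

  when : ∀ {p} {P : Set p} → Dec P → Carrier → Carrier
  when (yes _) x = x
  when (no _)  _ = 0ᴹ

  ·-zeroʳ : ∀ k → k · 0ᴹ ≈ 0ᴹ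
  ·-zeroʳ zero    = ≈-refl
  ·-zeroʳ (suc k) = ≈-trans (identityˡ _) (·-zeroʳ k)

  module _ {a} {A : Set a} where

    sum-congᴬ : ∀ {f g : A → Carrier} {L} → All (λ x → f x ≈ g x) L → sumList L f ≈ sumList L g
    sum-congᴬ []        = ≈-refl
    sum-congᴬ (e ∷ es) = ∙-cong e (sum-congᴬ es)

    sum-cong : ∀ {f g : A → Carrier} (L : List A) → (∀ x → f x ≈ g x) → sumList L f ≈ sumList L g
    sum-cong L f≈g = sum-congᴬ (All.universal f≈g L)

    sum-++ : (f : A → Carrier) (L L′ : List A) → sumList (L ++ L′) f ≈ sumList L f +ᴹ sumList L′ f
    sum-++ f []      L′ = ≈-sym (identityˡ _)
    sum-++ f (x ∷ L) L′ = ≈-trans (∙-congˡ (sum-++ f L L′)) (≈-sym (assoc _ _ _))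

    sum-zero : (L : List A) → (∑[ x ∈ L ] 0ᴹ) ≈ 0ᴹ
    sum-zero []      = ≈-refl
    sum-zero (x ∷ L) = ≈-trans (identityˡ _) (sum-zero L)

    sum-+ : (f g : A → Carrier) (L : List A) → (∑[ x ∈ L ] (f x +ᴹ g x)) ≈ sumList L f +ᴹ sumList L g
    sum-+ f g []      = ≈-sym (identityˡ 0ᴹ)
    sum-+ f g (x ∷ L) = begin
      (f x +ᴹ g x) +ᴹ (∑[ y ∈ L ] (f y +ᴹ g y))    ≈⟨ ∙-congˡ (sum-+ f g L) ⟩
      (f x +ᴹ g x) +ᴹ (sumList L f +ᴹ sumList L g) ≈⟨ interchange _ _ _ _ ⟩
      (f x +ᴹ sumList L f) +ᴹ (g x +ᴹ sumList L g) ∎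

    sum-filter : ∀ {p} {P : Pred A p} (P? : Decidable P) (f : A → Carrier) (L : List A) →
      sumList (filter P? L) f ≈ (∑[ x ∈ L ] when (P? x) (f x))
    sum-filter P? f [] = ≈-refl
    sum-filter P? f (x ∷ L) with P? x
    ... | yes _ = ∙-congˡ (sum-filter P? f L)
    ... | no _  = ≈-trans (sum-filter P? f L) (≈-sym (identityˡ _))

    sum-singleton : ∀ {f : A → Carrier} {v} (L : List A) → length L ≡ 1 → All (λ x → f x ≈ v) L → sumList L f ≈ v
    sum-singleton (x ∷ []) _ (fx≈v ∷ []) = ≈-trans (identityʳ _) fx≈v

    sum-const : (v : Carrier) (L : List A) → (∑[ x ∈ L ] v) ≈ length L · v
    sum-const v []      = ≈-refl
    sum-const v (x ∷ L) = ∙-congˡ (sum-const v L)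

  module _ {a b} {A : Set a} {B : Set b} where

    sum-map : (h : A → B) (f : B → Carrier) (L : List A) → sumList (map h L) f ≈ sumList L (f ∘ h)
    sum-map h f []      = ≈-refl
    sum-map h f (x ∷ L) = ∙-congˡ (sum-map h f L)

    sum-swap : (G : A → B → Carrier) (L : List A) (L′ : List B) →
      (∑[ x ∈ L ] ∑[ y ∈ L′ ] G x y) ≈ (∑[ y ∈ L′ ] ∑[ x ∈ L ] G x y)
    sum-swap G [] L′ = ≈-sym (sum-zero L′)
    sum-swap G (x ∷ L) L′ = ≈-trans (∙-congˡ (sum-swap G L L′)) (≈-sym (sum-+ (G x) _ L′))

    sum-swap-filter : ∀ {r} {R : A → B → Set r} (R? : ∀ x y → Dec (R x y))
      (G : A → B → Carrier) (L : List A) (L′ : List B) →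
      (∑[ x ∈ L ] ∑[ y ∈ filter (R? x) L′ ] G x y) ≈ (∑[ y ∈ L′ ] ∑[ x ∈ filter (λ x → R? x y) L ] G x y)
    sum-swap-filter R? G L L′ = begin
      (∑[ x ∈ L ] ∑[ y ∈ filter (R? x) L′ ] G x y)
        ≈⟨ sum-cong L (λ x → sum-filter (R? x) (G x) L′) ⟩
      (∑[ x ∈ L ] ∑[ y ∈ L′ ] when (R? x y) (G x y))
        ≈⟨ sum-swap (λ x y → when (R? x y) (G x y)) L L′ ⟩
      (∑[ y ∈ L′ ] ∑[ x ∈ L ] when (R? x y) (G x y))
        ≈⟨ sum-cong L′ (λ y → ≈-sym (sum-filter (λ x → R? x y) (λ x → G x y) L)) ⟩
      (∑[ y ∈ L′ ] ∑[ x ∈ filter (λ x → R? x y) L ] G x y) ∎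

  module _ {a b} {A : Set a} {B : Set b} where

    sum-cartesianProduct-proj₁ : (f : A → Carrier) (L : List A) (L′ : List B) →
      sumList (cartesianProduct L L′) (f ∘ proj₁) ≈ length L′ · sumList L f
    sum-cartesianProduct-proj₁ f [] L′ = ≈-sym (·-zeroʳ (length L′))
    sum-cartesianProduct-proj₁ f (x ∷ L) L′ = begin
      sumList (map (x ,_) L′ ++ cartesianProduct L L′) (f ∘ proj₁)
        ≈⟨ sum-++ (f ∘ proj₁) (map (x ,_) L′) (cartesianProduct L L′) ⟩
      sumList (map (x ,_) L′) (f ∘ proj₁) +ᴹ sumList (cartesianProduct L L′) (f ∘ proj₁)
        ≈⟨ ∙-cong (≈-trans (sum-map (x ,_) (f ∘ proj₁) L′) (sum-const (f x) L′))
                  (sum-cartesianProduct-proj₁ f L L′) ⟩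
      length L′ · f x +ᴹ length L′ · sumList L f
        ≈⟨ ≈-sym (×-distrib-+ (f x) (sumList L f) (length L′)) ⟩
      length L′ · (f x +ᴹ sumList L f) ∎

module Enumeration {a ℓ} (S : DecSetoid a ℓ) where

  open DecSetoid S using (_≈_; _≟_) renaming (Carrier to A; sym to ≈-sym)

  mult : A → List A → ℕ
  mult x = count (_≟ x)

  record Enumerates {p} (P : Pred A p) (L : List A) : Set (a ⊔ ℓ ⊔ p) where
    field
      sound : All P L
      once  : ∀ {x} → P x → mult x L ≡ 1

  open Enumerates public

  filter-enumerates : ∀ {p q} {P : Pred A p} {Q : Pred A q} {L} → Enumerates P L →
    (Q? : Decidable Q) → (∀ {x} → Q x → P x) → (∀ {x y} → x ≈ y → Q x → Q y) →
    Enumerates Q (filter Q? L)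
  filter-enumerates {L = L} enum Q? Q⇒P Q-resp = record
    { sound = all-filter Q? L
    ; once  = λ {x} Qx → trans (cong length (filter-absorb (_≟ x) Q? (λ y≈x → Q-resp (≈-sym y≈x) Qx) L))
                               (once enum (Q⇒P Qx))
    }

module _ {a b ℓa ℓb} (S : DecSetoid a ℓa) (T : DecSetoid b ℓb) where

  open DecSetoid S using () renaming (Carrier to A; _≈_ to _≈ˢ_; _≟_ to _≟ˢ_)
  open DecSetoid T using (_≟_) renaming (Carrier to B; _≈_ to _≈ᵀ_; sym to ≈ᵀ-sym; trans to ≈ᵀ-trans)
  open Enumeration S using () renaming (Enumerates to Enumeratesˢ; sound to soundˢ; once to onceˢ)
  open Enumeration T using () renaming (Enumerates to Enumeratesᵀ)

  record IsBijectionOn {p q} (P : Pred A p) (Q : Pred B q) (φ : A → B) : Set (a ⊔ b ⊔ ℓa ⊔ ℓb ⊔ p ⊔ q) where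
    field
      φ-cong     : ∀ {x y} → x ≈ˢ y → φ x ≈ᵀ φ y
      maps       : ∀ {x} → P x → Q (φ x)
      injective  : ∀ {x y} → P x → P y → φ x ≈ᵀ φ y → x ≈ˢ y
      surjective : ∀ {y} → Q y → ∃ λ x → P x × φ x ≈ᵀ y

  map-enumerates : ∀ {p q} {P : Pred A p} {Q : Pred B q} {φ : A → B} {L} →
    Enumeratesˢ P L → IsBijectionOn P Q φ → Enumeratesᵀ Q (map φ L)
  map-enumerates {P = P} {Q} {φ} {L} enum bij = record
    { sound = map⁺ (All.map maps (soundˢ enum))
    ; once  = once
    }
    where
    open IsBijectionOn bij
    once : ∀ {y} → Q y → count (_≟ y) (map φ L) ≡ 1
    once {y} Qy with surjective Qy
    ... | x₀ , Px₀ , φx₀≈y = begin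
      count (_≟ y) (map φ L)   ≡⟨ count-map (_≟ y) φ L ⟩
      count (λ x → φ x ≟ y) L  ≡⟨ cong length (filter-congᴬ (λ x → φ x ≟ y) (_≟ˢ x₀) (All.map same (soundˢ enum))) ⟩
      count (_≟ˢ x₀) L         ≡⟨ onceˢ enum Px₀ ⟩
      1                        ∎
      where
      open ≡-Reasoning
      same : ∀ {x} → P x → (φ x ≈ᵀ y → x ≈ˢ x₀) × (x ≈ˢ x₀ → φ x ≈ᵀ y)
      same Px = (λ φx≈y → injective Px Px₀ (≈ᵀ-trans φx≈y (≈ᵀ-sym φx₀≈y)))
              , (λ x≈x₀ → ≈ᵀ-trans (φ-cong x≈x₀) φx₀≈y)

module EnumerationSum {c ℓ} (M : CommutativeMonoid c ℓ) where

  open CommutativeMonoid M using (Carrier)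
    renaming (_≈_ to _≈ᴹ_; sym to ≈ᴹ-sym; trans to ≈ᴹ-trans; reflexive to ≈ᴹ-reflexive)
  open ListSum M
  open import Relation.Binary.Reasoning.Setoid (CommutativeMonoid.setoid M)

  module _ {a ℓa} (S : DecSetoid a ℓa) where

    open DecSetoid S using (_≈_; _≟_) renaming (Carrier to A; sym to ≈-sym)
    open Enumeration S

    sum-select : ∀ {p} {P : Pred A p} {L} {F : A → Carrier} → Enumerates P L →
      (∀ {x y} → x ≈ y → F x ≈ᴹ F y) → ∀ {x₀} → P x₀ → sumList (filter (_≟ x₀) L) F ≈ᴹ F x₀
    sum-select {L = L} enum F-cong Px₀ =
      sum-singleton (filter (_≟ _) L) (once enum Px₀) (All.map F-cong (all-filter (_≟ _) L))

    -- Two enumerations of the same predicate have the same sum (by double counting).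
    sum-enumerations : ∀ {p} {P : Pred A p} {L L′} {F : A → Carrier} → Enumerates P L → Enumerates P L′ →
      (∀ {x y} → x ≈ y → F x ≈ᴹ F y) → sumList L F ≈ᴹ sumList L′ F
    sum-enumerations {L = L} {L′} {F} enum enum′ F-cong = begin
      (∑[ x ∈ L ] F x)
        ≈⟨ sum-congᴬ (All.map (λ Px → ≈ᴹ-sym (sum-select enum′ F-cong Px)) (sound enum)) ⟩
      (∑[ x ∈ L ] ∑[ y ∈ filter (_≟ x) L′ ] F y)
        ≈⟨ sum-swap-filter (λ x y → y ≟ x) (λ _ y → F y) L L′ ⟩
      (∑[ y ∈ L′ ] ∑[ x ∈ filter (y ≟_) L ] F y)
        ≈⟨ sum-cong L′ reorient ⟩
      (∑[ y ∈ L′ ] ∑[ x ∈ filter (_≟ y) L ] F x)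
        ≈⟨ sum-congᴬ (All.map (sum-select enum F-cong) (sound enum′)) ⟩
      (∑[ y ∈ L′ ] F y) ∎
      where
      reorient : ∀ y → (∑[ x ∈ filter (y ≟_) L ] F y) ≈ᴹ (∑[ x ∈ filter (_≟ y) L ] F x)
      reorient y = ≈ᴹ-trans (sum-congᴬ (All.map F-cong (all-filter (y ≟_) L)))
                        (≈ᴹ-reflexive (cong (λ K → sumList K F) (filter-≐ (y ≟_) (_≟ y) (≈-sym , ≈-sym) L)))

  sum-bijection : ∀ {a b ℓa ℓb} (S : DecSetoid a ℓa) (T : DecSetoid b ℓb) →
    let open DecSetoid S using () renaming (Carrier to A)
        open DecSetoid T using () renaming (Carrier to B; _≈_ to _≈ᵀ_) in
    ∀ {p q} {P : Pred A p} {Q : Pred B q} {φ : A → B} {L₁ L₂} {F : B → Carrier} →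
    Enumeration.Enumerates S P L₁ → Enumeration.Enumerates T Q L₂ → IsBijectionOn S T P Q φ →
    (∀ {x y} → x ≈ᵀ y → F x ≈ᴹ F y) → sumList L₁ (F ∘ φ) ≈ᴹ sumList L₂ F
  sum-bijection S T {φ = φ} {L₁} {F = F} enum₁ enum₂ bij F-cong =
    ≈ᴹ-trans (≈ᴹ-sym (sum-map φ F L₁)) (sum-enumerations T (map-enumerates S T enum₁ bij) enum₂ F-cong)

allFin-suc : ∀ n → allFin (suc n) ≡ Fin.zero ∷ map Fin.suc (allFin n)
allFin-suc n = cong (Fin.zero ∷_) (sym (map-tabulate (λ i → i) Fin.suc))

count-allFin : ∀ n (x : Fin n) → count (_≟ᶠ x) (allFin n) ≡ 1
count-allFin (suc n) x = trans (cong (count (_≟ᶠ x)) (allFin-suc n)) (at x)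
  where
  open ≡-Reasoning
  at : ∀ x → count (_≟ᶠ x) (Fin.zero ∷ map Fin.suc (allFin n)) ≡ 1
  at Fin.zero = cong suc (begin
    count (_≟ᶠ Fin.zero) (map Fin.suc (allFin n))   ≡⟨ count-map (_≟ᶠ Fin.zero) Fin.suc (allFin n) ⟩
    count (λ i → Fin.suc i ≟ᶠ Fin.zero) (allFin n)  ≡⟨ cong length (filter-none _ (All.universal (λ _ ()) (allFin n))) ⟩
    0                                               ∎)
  at (Fin.suc x) = begin
    count (_≟ᶠ Fin.suc x) (map Fin.suc (allFin n))   ≡⟨ count-map (_≟ᶠ Fin.suc x) Fin.suc (allFin n) ⟩
    count (λ i → Fin.suc i ≟ᶠ Fin.suc x) (allFin n)  ≡⟨ cong length (filter-≐ _ (_≟ᶠ x) (suc-injective , cong Fin.suc) (allFin n)) ⟩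
    count (_≟ᶠ x) (allFin n)                         ≡⟨ count-allFin n x ⟩
    1                                                ∎

allFin-enumerates : ∀ n → Enumeration.Enumerates (≡-decSetoid n) U (allFin n)
allFin-enumerates n = record { sound = All.universal _ (allFin n) ; once = λ {x} _ → count-allFin n x }

_≗?_ : ∀ {n k} (f g : Fin n → Fin k) → Dec (f ≗ g)
f ≗? g = all? (λ i → f i ≟ᶠ g i)

Funs : ℕ → ℕ → DecSetoid 0ℓ 0ℓ
Funs n k = record
  { Carrier          = Fin n → Fin k
  ; _≈_              = _≗_
  ; isDecEquivalence = record
    { isEquivalence = Setoid.isEquivalence (Fin n →-setoid Fin k)
    ; _≟_           = _≗?_
    }
  }

count-allFuns : ∀ n k (z : Fin n → Fin k) → count (_≗? z) (allFuns n k) ≡ 1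
count-allFuns zero    k z = refl
count-allFuns (suc n) k z =
  trans (count-concatMap (_≗? z) (_≗? (z ∘ Fin.suc)) row one none (allFuns n k)) (count-allFuns n k (z ∘ Fin.suc))
  where
  row : (Fin n → Fin k) → List (Fin (suc n) → Fin k)
  row f = map (λ a → cons a f) (allFin k)
  one : ∀ {f} → f ≗ z ∘ Fin.suc → count (_≗? z) (row f) ≡ 1
  one {f} f≗ = begin
    count (_≗? z) (row f)                   ≡⟨ count-map (_≗? z) (λ a → cons a f) (allFin k) ⟩
    count (λ a → cons a f ≗? z) (allFin k)  ≡⟨ cong length (filter-≐ _ (_≟ᶠ z Fin.zero) (head≡ , cons≗) (allFin k)) ⟩
    count (_≟ᶠ z Fin.zero) (allFin k)       ≡⟨ count-allFin k (z Fin.zero) ⟩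
    1                                       ∎
    where
    open ≡-Reasoning
    -- Given its tail, cons a f agrees with z exactly when its head does.
    head≡ : ∀ {a} → cons a f ≗ z → a ≡ z Fin.zero
    head≡ e = e Fin.zero
    cons≗ : ∀ {a} → a ≡ z Fin.zero → cons a f ≗ z
    cons≗ e Fin.zero    = e
    cons≗ e (Fin.suc i) = f≗ i
  none : ∀ {f} → ¬ f ≗ z ∘ Fin.suc → count (_≗? z) (row f) ≡ 0
  none {f} f≉ = trans (count-map (_≗? z) (λ a → cons a f) (allFin k))
                      (cong length (filter-none _ (All.universal (λ a e → f≉ (e ∘ Fin.suc)) (allFin k))))

allFuns-enumerates : ∀ n k → Enumeration.Enumerates (Funs n k) U (allFuns n k)
allFuns-enumerates n k = record { sound = All.universal _ (allFuns n k) ; once = λ {z} _ → count-allFuns n k z }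

cartesianProduct-enumerates : ∀ {a b ℓa ℓb p q} (S : DecSetoid a ℓa) (T : DecSetoid b ℓb) →
  let open DecSetoid S using () renaming (Carrier to A)
      open DecSetoid T using () renaming (Carrier to B) in
  ∀ {P : Pred A p} {Q : Pred B q} {L L′} →
  Enumeration.Enumerates S P L → Enumeration.Enumerates T Q L′ →
  Enumeration.Enumerates (×-decSetoid S T) (λ xy → P (proj₁ xy) × Q (proj₂ xy)) (cartesianProduct L L′)
cartesianProduct-enumerates S T {P = P} {Q} {L} {L′} enum enum′ = record
  { sound = subst (All _) (sym (cartesianProduct-rows L L′))
                  (concat⁺ (map⁺ (All.map (λ Px → map⁺ (All.map (Px ,_) (sound enum′))) (sound enum))))
  ; once  = λ { {x , y} (Px , Qy) → trans (cong (count (_≟ₓ (x , y))) (cartesianProduct-rows L L′))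
                                   (trans (count-concatMap (_≟ₓ (x , y)) (_≟ˢ x) (λ a → map (a ,_) L′) (one Qy) none L)
                                          (once enum Px)) }
  }
  where
  open Enumeration using (sound; once)
  open DecSetoid S using () renaming (_≟_ to _≟ˢ_; _≈_ to _≈ˢ_)
  open DecSetoid T using () renaming (_≟_ to _≟ᵀ_)
  open DecSetoid (×-decSetoid S T) using () renaming (_≟_ to _≟ₓ_)
  one : ∀ {x y a} → Q y → a ≈ˢ x → count (_≟ₓ (x , y)) (map (a ,_) L′) ≡ 1
  one {x} {y} {a} Qy a≈x = trans (count-map (_≟ₓ (x , y)) (a ,_) L′)
    (trans (cong length (filter-≐ (λ b → (a , b) ≟ₓ (x , y)) (_≟ᵀ y) (proj₂ , (a≈x ,_)) L′)) (once enum′ Qy))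
  none : ∀ {x y a} → ¬ a ≈ˢ x → count (_≟ₓ (x , y)) (map (a ,_) L′) ≡ 0
  none {x} {y} {a} a≉x = trans (count-map (_≟ₓ (x , y)) (a ,_) L′)
    (cong length (filter-none (λ b → (a , b) ≟ₓ (x , y)) (All.universal (λ b → a≉x ∘ proj₁) L′)))

IsPerm-∘ : ∀ {n} {f g : Fin n → Fin n} → IsPerm n f → IsPerm n g → IsPerm n (f ∘ g)
IsPerm-∘ {f = f} (f-inj , f-surj) (g-inj , g-surj) =
  (λ i j e → g-inj i j (f-inj _ _ e)) ,
  (λ y → let (x′ , fx′≡y) = f-surj y ; (x , gx≡x′) = g-surj x′ in x , trans (cong f gx≡x′) fx′≡y)

Permutation-IsPerm : ∀ {n} (π : Permutation′ n) → IsPerm n (π ⟨$⟩ʳ_)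
Permutation-IsPerm π =
  (λ i j e → trans (sym (inverseˡ π)) (trans (cong (π ⟨$⟩ˡ_) e) (inverseˡ π))) ,
  (λ y → π ⟨$⟩ˡ y , inverseʳ π)

transpose-matchˡ : ∀ {n} (i j : Fin n) → PC.transpose i j i ≡ j
transpose-matchˡ i j with i ≟ᶠ i
... | yes _  = refl
... | no i≢i = contradiction refl i≢i

transpose-other : ∀ {n} {i j k : Fin n} → k ≢ i → k ≢ j → PC.transpose i j k ≡ k
transpose-other {i = i} {j} {k} k≢i k≢j with k ≟ᶠ i
... | yes k≡i = contradiction k≡i k≢i
... | no _ with k ≟ᶠ j
...   | yes k≡j = contradiction k≡j k≢j
...   | no _    = refl

last-or-inject₁ : ∀ {n} (x : Fin (suc n)) → x ≡ fromℕ n ⊎ ∃ λ i → x ≡ inject₁ i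
last-or-inject₁ {n} x with n ≟ℕ toℕ x
... | yes n≡x = inj₁ (toℕ-injective (trans (sym n≡x) (sym (toℕ-fromℕ n))))
... | no n≢x  = inj₂ (lower₁ x n≢x , sym (inject₁-lower₁ x n≢x))

extend : ∀ {n} → (Fin n → Fin n) → Fin (suc n) → Fin (suc n)
extend {n} σ x with n ≟ℕ toℕ x
... | yes _  = fromℕ n
... | no n≢x = inject₁ (σ (lower₁ x n≢x))

extend-last : ∀ {n} (σ : Fin n → Fin n) → extend σ (fromℕ n) ≡ fromℕ n
extend-last {n} σ with n ≟ℕ toℕ (fromℕ n)
... | yes _  = refl
... | no n≢n = contradiction (sym (toℕ-fromℕ n)) n≢n

extend-inject₁ : ∀ {n} (σ : Fin n → Fin n) i → extend σ (inject₁ i) ≡ inject₁ (σ i)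
extend-inject₁ {n} σ i with n ≟ℕ toℕ (inject₁ i)
... | yes n≡i = contradiction n≡i (toℕ-inject₁-≢ i)
... | no n≢i  = cong (inject₁ ∘ σ) (lower₁-inject₁′ i n≢i)

extend-cong : ∀ {n} {σ τ : Fin n → Fin n} → σ ≗ τ → extend σ ≗ extend τ
extend-cong {n} σ≗τ x with n ≟ℕ toℕ x
... | yes _  = refl
... | no n≢x = cong inject₁ (σ≗τ (lower₁ x n≢x))

extend-IsPerm : ∀ {n} {σ : Fin n → Fin n} → IsPerm n σ → IsPerm (suc n) (extend σ)
extend-IsPerm {n} {σ} (σ-inj , σ-surj) = injective , surjective
  where
  last≢ : ∀ {i} → extend σ (fromℕ n) ≢ extend σ (inject₁ i)
  last≢ {i} e = fromℕ≢inject₁ (trans (sym (extend-last σ)) (trans e (extend-inject₁ σ i)))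
  injective : ∀ x y → extend σ x ≡ extend σ y → x ≡ y
  injective x y e with last-or-inject₁ x | last-or-inject₁ y
  ... | inj₁ refl       | inj₁ refl       = refl
  ... | inj₁ refl       | inj₂ (j , refl) = contradiction e last≢
  ... | inj₂ (i , refl) | inj₁ refl       = contradiction (sym e) last≢
  ... | inj₂ (i , refl) | inj₂ (j , refl) =
    cong inject₁ (σ-inj i j (inject₁-injective (trans (sym (extend-inject₁ σ i)) (trans e (extend-inject₁ σ j)))))
  surjective : ∀ y → ∃ λ x → extend σ x ≡ y
  surjective y with last-or-inject₁ y
  ... | inj₁ refl       = fromℕ n , extend-last σ
  ... | inj₂ (j , refl) = let (i , σi≡j) = σ-surj j in inject₁ i , trans (extend-inject₁ σ i) (cong inject₁ σi≡j)

module Restrict {n} (τ : Fin (suc n) → Fin (suc n)) (τ-inj : ∀ x y → τ x ≡ τ y → x ≡ y)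
                (τ-last : τ (fromℕ n) ≡ fromℕ n) where

  restrict : Fin n → Fin n
  restrict i = lower₁ (τ (inject₁ i)) n≢
    where
    n≢ : n ≢ toℕ (τ (inject₁ i))
    n≢ e = fromℕ≢inject₁ (τ-inj _ _ (trans τ-last (toℕ-injective (trans (toℕ-fromℕ n) e))))

  inject₁-restrict : ∀ i → inject₁ (restrict i) ≡ τ (inject₁ i)
  inject₁-restrict i = inject₁-lower₁ _ _

  restrict-IsPerm : (∀ y → ∃ λ x → τ x ≡ y) → IsPerm n restrict
  restrict-IsPerm τ-surj = injective , surjective
    where
    injective : ∀ i j → restrict i ≡ restrict j → i ≡ j
    injective i j e = inject₁-injective (τ-inj _ _
      (trans (sym (inject₁-restrict i)) (trans (cong inject₁ e) (inject₁-restrict j))))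
    surjective : ∀ y → ∃ λ i → restrict i ≡ y
    surjective y with τ-surj (inject₁ y)
    ... | x , τx≡y with last-or-inject₁ x
    ...   | inj₁ refl       = contradiction (trans (sym τ-last) τx≡y) fromℕ≢inject₁
    ...   | inj₂ (i , refl) = i , inject₁-injective (trans (inject₁-restrict i) τx≡y)

  extend-restrict : extend restrict ≗ τ
  extend-restrict x with last-or-inject₁ x
  ... | inj₁ refl       = trans (extend-last restrict) (sym τ-last)
  ... | inj₂ (i , refl) = trans (extend-inject₁ restrict i) (inject₁-restrict i)

InS-resp : ∀ {n m ν} {σ τ : Fin n → Fin n} → σ ≗ τ → InS n m ν σ → InS n m ν τ
InS-resp {m = m} σ≗τ ((σ-inj , σ-surj) , σ-cond) =
  ((λ i j e → σ-inj i j (trans (σ≗τ i) (trans e (sym (σ≗τ j))))) ,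
   (λ y → let (x , σx≡y) = σ-surj y in x , trans (sym (σ≗τ x)) σx≡y)) ,
  (λ i νi≥1 → subst (λ z → suc (toℕ z) ≤ m) (σ≗τ i) (σ-cond i νi≥1))

Slist-enumerates : ∀ n m ν → Enumeration.Enumerates (Funs n n) (InS n m ν) (Slist n m ν)
Slist-enumerates n m ν = Enumeration.filter-enumerates (Funs n n) (allFuns-enumerates n n) (inS? n m ν) _ InS-resp

Slist-cong : ∀ n m {ν μ : Fin n → ℕ} → ν ≗ μ → Slist n m ν ≡ Slist n m μ
Slist-cong n m {ν} {μ} ν≗μ = filter-≐ (inS? n m ν) (inS? n m μ) (resp ν≗μ , resp (sym ∘ ν≗μ)) (allFuns n n)
  where
  resp : ∀ {ν μ : Fin n → ℕ} {σ} → ν ≗ μ → InS n m ν σ → InS n m μ σ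
  resp ν≗μ (σ-perm , σ-cond) = σ-perm , (λ i μi≥1 → σ-cond i (subst (1 ≤_) (sym (ν≗μ i)) μi≥1))

Σℕ-cong : ∀ n {f g : Fin n → ℕ} → f ≗ g → Σℕ n f ≡ Σℕ n g
Σℕ-cong zero    f≗g = refl
Σℕ-cong (suc n) f≗g = cong₂ _+_ (f≗g Fin.zero) (Σℕ-cong n (f≗g ∘ Fin.suc))

Σℕ≡sum : ∀ n (f : Fin n → ℕ) → Σℕ n f ≡ ℕSum.sum f
Σℕ≡sum zero    f = refl
Σℕ≡sum (suc n) f = cong (f Fin.zero +_) (Σℕ≡sum n (f ∘ Fin.suc))

weight-cong : ∀ a b k → (1 ≤ k → a ≡ b) → suc a * k ≡ suc b * k
weight-cong a b zero    _    = trans (*-zeroʳ (suc a)) (sym (*-zeroʳ (suc b)))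
weight-cong a b (suc k) a≡b = cong (λ x → suc x * suc k) (a≡b (s≤s z≤n))

expo-cong-support : ∀ n (ν : Fin n → ℕ) {σ τ : Fin n → Fin n} →
  (∀ i → 1 ≤ ν i → toℕ (σ i) ≡ toℕ (τ i)) → expo n ν σ ≡ expo n ν τ
expo-cong-support n ν agree = Σℕ-cong n (λ i → weight-cong _ _ (ν i) (agree i))

expo-permute : ∀ n (π : Permutation′ n) (ν : Fin n → ℕ) (σ : Fin n → Fin n) →
  expo n (ν ∘ (π ⟨$⟩ʳ_)) σ ≡ expo n ν (σ ∘ (π ⟨$⟩ˡ_))
expo-permute n π ν σ = begin
  Σℕ n (λ i → suc (toℕ (σ i)) * ν (π ⟨$⟩ʳ i))
    ≡⟨ Σℕ-cong n (λ i → cong (λ j → suc (toℕ (σ j)) * ν (π ⟨$⟩ʳ i)) (sym (inverseˡ π))) ⟩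
  Σℕ n (f ∘ (π ⟨$⟩ʳ_))      ≡⟨ Σℕ≡sum n (f ∘ (π ⟨$⟩ʳ_)) ⟩
  ℕSum.sum (f ∘ (π ⟨$⟩ʳ_))  ≡⟨ ℕSum.sum-permute f π ⟨
  ℕSum.sum f                ≡⟨ Σℕ≡sum n f ⟨
  Σℕ n f                    ∎
  where
  open ≡-Reasoning
  f : Fin n → ℕ
  f j = suc (toℕ (σ (π ⟨$⟩ˡ j))) * ν j

expo-drop-last : ∀ n (ν : Fin (suc n) → ℕ) (τ : Fin (suc n) → Fin (suc n)) (σ : Fin n → Fin n) →
  ν (fromℕ n) ≡ 0 → (∀ i → 1 ≤ ν (inject₁ i) → toℕ (τ (inject₁ i)) ≡ toℕ (σ i)) →
  expo (suc n) ν τ ≡ expo n (ν ∘ inject₁) σ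
expo-drop-last n ν τ σ ν-last agree = begin
  expo (suc n) ν τ                       ≡⟨ trans (Σℕ≡sum (suc n) t) (ℕSum.sum-init-last t) ⟩
  ℕSum.sum (t ∘ inject₁) + a * ν (fromℕ n) ≡⟨ cong₂ _+_ (sym (Σℕ≡sum n (t ∘ inject₁))) (cong (a *_) ν-last) ⟩
  Σℕ n (t ∘ inject₁) + a * 0               ≡⟨ trans (cong (Σℕ n (t ∘ inject₁) +_) (*-zeroʳ a)) (+-identityʳ _) ⟩
  Σℕ n (t ∘ inject₁)                       ≡⟨ Σℕ-cong n (λ i → weight-cong _ _ (ν (inject₁ i)) (agree i)) ⟩
  expo n (ν ∘ inject₁) σ                   ∎
  where
  open ≡-Reasoning
  t : Fin (suc n) → ℕ
  t x = suc (toℕ (τ x)) * ν x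
  a : ℕ
  a = suc (toℕ (τ (fromℕ n)))

count-zeros : ∀ n (ν : Fin n → ℕ) → count (λ q → ν q ≟ℕ 0) (allFin n) + ℓ n ν ≡ n
count-zeros zero    ν = refl
count-zeros (suc n) ν = trans (cong (λ L → count (λ q → ν q ≟ℕ 0) L + ℓ (suc n) ν) (allFin-suc n)) split
  where
  rest : count (λ q → ν q ≟ℕ 0) (map Fin.suc (allFin n)) + ℓ n (ν ∘ Fin.suc) ≡ n
  rest = trans (cong (_+ ℓ n (ν ∘ Fin.suc)) (count-map (λ q → ν q ≟ℕ 0) Fin.suc (allFin n))) (count-zeros n (ν ∘ Fin.suc))
  split : count (λ q → ν q ≟ℕ 0) (Fin.zero ∷ map Fin.suc (allFin n)) + ℓ (suc n) ν ≡ suc n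
  split with ν Fin.zero
  ... | zero  = cong suc rest
  ... | suc _ = trans (+-suc _ _) (cong suc rest)

ℓ-bound : ∀ n (ν : Fin n → ℕ) → ℓ n ν ≤ n
ℓ-bound n ν = subst (ℓ n ν ≤_) (count-zeros n ν) (m≤n+m (ℓ n ν) _)

ℓ-drop-last : ∀ n (ν : Fin (suc n) → ℕ) → ν (fromℕ n) ≡ 0 → ℓ (suc n) ν ≡ ℓ n (ν ∘ inject₁)
ℓ-drop-last zero ν ν-last with ν Fin.zero
... | zero = refl
ℓ-drop-last zero ν () | suc _
ℓ-drop-last (suc n) ν ν-last with ν Fin.zero
... | zero  = ℓ-drop-last n (ν ∘ Fin.suc) ν-last
... | suc _ = cong suc (ℓ-drop-last n (ν ∘ Fin.suc) ν-last)

precompose-bijection : ∀ n m (π : Permutation′ n) (ν : Fin n → ℕ) →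
  IsBijectionOn (Funs n n) (Funs n n) (InS n m (ν ∘ (π ⟨$⟩ʳ_))) (InS n m ν) (_∘ (π ⟨$⟩ˡ_))
precompose-bijection n m π ν = record
  { φ-cong     = λ σ≗τ i → σ≗τ (π ⟨$⟩ˡ i)
  ; maps       = λ { (σ-perm , σ-cond) →
                     IsPerm-∘ σ-perm (Permutation-IsPerm (flip π)) ,
                     (λ i νi≥1 → σ-cond (π ⟨$⟩ˡ i) (subst (1 ≤_) (cong ν (sym (inverseʳ π))) νi≥1)) }
  ; injective  = λ {σ} {τ} _ _ e i → trans (cong σ (sym (inverseˡ π))) (trans (e (π ⟨$⟩ʳ i)) (cong τ (inverseˡ π)))
  ; surjective = λ { {τ} (τ-perm , τ-cond) →
                     τ ∘ (π ⟨$⟩ʳ_) ,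
                     (IsPerm-∘ τ-perm (Permutation-IsPerm π) , (λ i → τ-cond (π ⟨$⟩ʳ i))) ,
                     (λ i → cong τ (inverseʳ π)) }
  }

module DropLast {n m} (m≤n : m ≤ n) (ν : Fin (suc n) → ℕ) (ν-last : ν (fromℕ n) ≡ 0) where

  ν′ : Fin n → ℕ
  ν′ = ν ∘ inject₁

  Zeros : List (Fin (suc n))
  Zeros = filter (λ q → ν q ≟ℕ 0) (allFin (suc n))

  Zeros-enumerates : Enumeration.Enumerates (≡-decSetoid (suc n)) (λ q → ν q ≡ 0) Zeros
  Zeros-enumerates = Enumeration.filter-enumerates (≡-decSetoid (suc n)) (allFin-enumerates (suc n))
                       (λ q → ν q ≟ℕ 0) _ (λ { refl νq≡0 → νq≡0 })

  Zeros-length : length Zeros ≡ suc n ∸ ℓ (suc n) ν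
  Zeros-length = trans (sym (m+n∸n≡m (length Zeros) (ℓ (suc n) ν))) (cong (_∸ ℓ (suc n) ν) (count-zeros (suc n) ν))

  Pairs : DecSetoid 0ℓ 0ℓ
  Pairs = ×-decSetoid (Funs n n) (≡-decSetoid (suc n))

  Admissible : (Fin n → Fin n) × Fin (suc n) → Set
  Admissible (σ′ , q) = InS n m ν′ σ′ × ν q ≡ 0

  Admissible-enumerates : Enumeration.Enumerates Pairs Admissible (cartesianProduct (Slist n m ν′) Zeros)
  Admissible-enumerates =
    cartesianProduct-enumerates (Funs n n) (≡-decSetoid (suc n)) (Slist-enumerates n m ν′) Zeros-enumerates

  swap : Fin (suc n) → Permutation′ (suc n)
  swap q = transpose q (fromℕ n)

  glue : (Fin n → Fin n) × Fin (suc n) → Fin (suc n) → Fin (suc n)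
  glue (σ′ , q) = extend σ′ ∘ (swap q ⟨$⟩ʳ_)

  support≢zero : ∀ {x y} → 1 ≤ ν x → ν y ≡ 0 → x ≢ y
  support≢zero νx≥1 νy≡0 refl = contradiction (subst (1 ≤_) νy≡0 νx≥1) λ ()

  transpose-support : ∀ {q r x} → ν q ≡ 0 → ν r ≡ 0 → 1 ≤ ν x → PC.transpose q r x ≡ x
  transpose-support νq≡0 νr≡0 νx≥1 = transpose-other (support≢zero νx≥1 νq≡0) (support≢zero νx≥1 νr≡0)

  glue-support : ∀ {σ′ q} i → ν q ≡ 0 → 1 ≤ ν′ i → glue (σ′ , q) (inject₁ i) ≡ inject₁ (σ′ i)
  glue-support {σ′} i νq≡0 νi≥1 = trans (cong (extend σ′) (transpose-support νq≡0 ν-last νi≥1)) (extend-inject₁ σ′ i)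

  glue-zero : ∀ σ′ q → glue (σ′ , q) q ≡ fromℕ n
  glue-zero σ′ q = trans (cong (extend σ′) (transpose-matchˡ q (fromℕ n))) (extend-last σ′)

  preimage-last-zero : ∀ {σ q} → Cond (suc n) m ν σ → σ q ≡ fromℕ n → ν q ≡ 0
  preimage-last-zero {σ} {q} σ-cond σq≡last with ν q in νq
  ... | zero  = refl
  ... | suc _ = contradiction m≤n (<⇒≱ n<m)
    where
    n<m : n < m
    n<m = subst (λ z → suc z ≤ m) (toℕ-fromℕ n)
                (subst (λ z → suc (toℕ z) ≤ m) σq≡last (σ-cond q (subst (1 ≤_) (sym νq) (s≤s z≤n))))

  -- Glued functions lie in S_{n+1,m}(ν): the support of ν stays within the first n points.
  glue-maps : ∀ {p} → Admissible p → InS (suc n) m ν (glue p)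
  glue-maps {σ′ , q} ((σ′-perm , σ′-cond) , νq≡0) =
    IsPerm-∘ (extend-IsPerm σ′-perm) (Permutation-IsPerm (swap q)) , cond
    where
    cond : Cond (suc n) m ν (glue (σ′ , q))
    cond x νx≥1 with last-or-inject₁ x
    ... | inj₁ refl       = contradiction refl (support≢zero νx≥1 ν-last)
    ... | inj₂ (i , refl) = subst (λ z → suc z ≤ m) (sym (trans (cong toℕ glued) (toℕ-inject₁ (σ′ i)))) (σ′-cond i νx≥1)
      where
      glued : glue (σ′ , q) (inject₁ i) ≡ inject₁ (σ′ i)
      glued = glue-support i νq≡0 νx≥1

  -- q is recovered as the preimage of the last point, and then σ′ from the values on Fin n.
  glue-injective : ∀ {p p′} → Admissible p → Admissible p′ → glue p ≗ glue p′ →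
    DecSetoid._≈_ Pairs p p′
  glue-injective {σ′ , q} {σ″ , q′} _ adm″ glue≗ = agree q≡q′ , q≡q′
    where
    glue″-injective : ∀ x y → glue (σ″ , q′) x ≡ glue (σ″ , q′) y → x ≡ y
    glue″-injective = proj₁ (proj₁ (glue-maps adm″))
    q≡q′ : q ≡ q′
    q≡q′ = glue″-injective q q′ (trans (sym (glue≗ q)) (trans (glue-zero σ′ q) (sym (glue-zero σ″ q′))))
    glue-at : ∀ σ i → glue (σ , q) (swap q ⟨$⟩ˡ inject₁ i) ≡ inject₁ (σ i)
    glue-at σ i = trans (cong (extend σ) (inverseʳ (swap q))) (extend-inject₁ σ i)
    agree : q ≡ q′ → σ′ ≗ σ″
    agree refl i =
      inject₁-injective (trans (sym (glue-at σ′ i)) (trans (glue≗ (swap q ⟨$⟩ˡ inject₁ i)) (glue-at σ″ i)))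

  -- Every σ ∈ S_{n+1,m}(ν) is glued from its restriction and the preimage q of the last point.
  glue-surjective : ∀ {σ} → InS (suc n) m ν σ → ∃ λ p → Admissible p × glue p ≗ σ
  glue-surjective {σ} (σ-perm , σ-cond) =
    (restrict , q) , ((restrict-IsPerm (proj₂ τ-perm) , restrict-cond) , νq≡0) , glue≗σ
    where
    q : Fin (suc n)
    q = proj₁ (proj₂ σ-perm (fromℕ n))
    σq≡last : σ q ≡ fromℕ n
    σq≡last = proj₂ (proj₂ σ-perm (fromℕ n))
    νq≡0 : ν q ≡ 0
    νq≡0 = preimage-last-zero σ-cond σq≡last
    τ : Fin (suc n) → Fin (suc n)
    τ = σ ∘ (swap q ⟨$⟩ˡ_)
    τ-perm : IsPerm (suc n) τ
    τ-perm = IsPerm-∘ σ-perm (Permutation-IsPerm (flip (swap q)))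
    τ-last : τ (fromℕ n) ≡ fromℕ n
    τ-last = trans (cong σ (transpose-matchˡ (fromℕ n) q)) σq≡last
    open Restrict τ (proj₁ τ-perm) τ-last
    restrict-cond : Cond n m ν′ restrict
    restrict-cond i νi≥1 = subst (λ z → suc z ≤ m) same (σ-cond (inject₁ i) νi≥1)
      where
      same : toℕ (σ (inject₁ i)) ≡ toℕ (restrict i)
      same = trans (cong (toℕ ∘ σ) (sym (transpose-support ν-last νq≡0 νi≥1)))
                   (trans (cong toℕ (sym (inject₁-restrict i))) (toℕ-inject₁ (restrict i)))
    glue≗σ : glue (restrict , q) ≗ σ
    glue≗σ x = trans (extend-restrict (swap q ⟨$⟩ʳ x)) (cong σ (inverseˡ (swap q)))

  glue-bijection : IsBijectionOn Pairs (Funs (suc n) (suc n)) Admissible (InS (suc n) m ν) glue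
  glue-bijection = record
    { φ-cong     = λ { {σ′ , q} {σ″ , .q} (σ′≗σ″ , refl) x → extend-cong σ′≗σ″ (swap q ⟨$⟩ʳ x) }
    ; maps       = glue-maps
    ; injective  = glue-injective
    ; surjective = glue-surjective
    }

  glue-expo : ∀ {p} → Admissible p → expo (suc n) ν (glue p) ≡ expo n ν′ (proj₁ p)
  glue-expo {σ′ , q} (_ , νq≡0) = expo-drop-last n ν (glue (σ′ , q)) σ′ ν-last
    (λ i νi≥1 → trans (cong toℕ (glue-support i νq≡0 νi≥1)) (toℕ-inject₁ (σ′ i)))

factorialRatio : ℕ → ℕ → ℕ
factorialRatio a b = _/_ (a !) (b !) {{b !≢0}}

factorialRatio-refl : ∀ a → factorialRatio a a ≡ 1
factorialRatio-refl a = n/n≡1 (a !) {{a !≢0}}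

factorialRatio-suc : ∀ {a b} → b ≤ a → suc a * factorialRatio a b ≡ factorialRatio (suc a) b
factorialRatio-suc {a} {b} b≤a = sym (*-/-assoc (suc a) {{b !≢0}} (m≤n⇒m!∣n! b≤a))

factorialRatio-∸ : ∀ {n m L} → L ≤ n → m ≤ n →
  (suc n ∸ L) * factorialRatio (n ∸ L) (m ∸ L) ≡ factorialRatio (suc n ∸ L) (m ∸ L)
factorialRatio-∸ {n} {m} {L} L≤n m≤n = begin
  (suc n ∸ L) * factorialRatio (n ∸ L) (m ∸ L)    ≡⟨ cong (_* factorialRatio (n ∸ L) (m ∸ L)) n+1∸L ⟩
  suc (n ∸ L) * factorialRatio (n ∸ L) (m ∸ L)    ≡⟨ factorialRatio-suc (∸-monoˡ-≤ L m≤n) ⟩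
  factorialRatio (suc (n ∸ L)) (m ∸ L)            ≡⟨ cong (λ k → factorialRatio k (m ∸ L)) n+1∸L ⟨
  factorialRatio (suc n ∸ L) (m ∸ L)              ∎
  where
  open ≡-Reasoning
  n+1∸L : suc n ∸ L ≡ suc (n ∸ L)
  n+1∸L = +-∸-assoc 1 L≤n

module USums {c ℓ′} (R : CommutativeRing c ℓ′) (ζ : CommutativeRing.Carrier R) where

  open CommutativeRing R using (Carrier; _≈_; +-commutativeMonoid; semiring) renaming (reflexive to ≈-reflexive)
  open import Algebra.Definitions.RawSemiring (Semiring.rawSemiring semiring) using (_^_)
  open import Algebra.Properties.CommutativeMonoid.Mult +-commutativeMonoid using (×-congʳ; ×-assocˡ)
  open ListSum +-commutativeMonoid
  open EnumerationSum +-commutativeMonoid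
  open import Relation.Binary.Reasoning.Setoid (CommutativeRing.setoid R)

  term : ∀ n → (Fin n → ℕ) → (Fin n → Fin n) → Carrier
  term n ν σ = ζ ^ expo n ν σ

  term-cong : ∀ {n} (ν : Fin n → ℕ) {σ τ : Fin n → Fin n} → σ ≗ τ → term n ν σ ≈ term n ν τ
  term-cong {n} ν σ≗τ = ≈-reflexive (cong (ζ ^_) (expo-cong-support n ν (λ i _ → cong toℕ (σ≗τ i))))

  u-cong : ∀ n m {ν μ : Fin n → ℕ} → ν ≗ μ → u R ζ n m ν ≈ u R ζ n m μ
  u-cong n m {ν} {μ} ν≗μ = begin
    sumList (Slist n m ν) (term n ν)  ≡⟨ cong (λ L → sumList L (term n ν)) (Slist-cong n m ν≗μ) ⟩
    sumList (Slist n m μ) (term n ν)  ≈⟨ sum-cong (Slist n m μ) (λ σ → ≈-reflexive (cong (ζ ^_) (same-expo σ))) ⟩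
    sumList (Slist n m μ) (term n μ)  ∎
    where
    same-expo : ∀ σ → expo n ν σ ≡ expo n μ σ
    same-expo σ = Σℕ-cong n (λ i → cong (suc (toℕ (σ i)) *_) (ν≗μ i))

  u-symmetric : ∀ n m (π : Permutation′ n) (ν : Fin n → ℕ) → u R ζ n m (ν ∘ (π ⟨$⟩ʳ_)) ≈ u R ζ n m ν
  u-symmetric n m π ν = begin
    sumList (Slist n m (ν ∘ (π ⟨$⟩ʳ_))) (term n (ν ∘ (π ⟨$⟩ʳ_)))
      ≈⟨ sum-cong (Slist n m (ν ∘ (π ⟨$⟩ʳ_))) (λ σ → ≈-reflexive (cong (ζ ^_) (expo-permute n π ν σ))) ⟩
    sumList (Slist n m (ν ∘ (π ⟨$⟩ʳ_))) (λ σ → term n ν (σ ∘ (π ⟨$⟩ˡ_)))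
      ≈⟨ sum-bijection (Funs n n) (Funs n n) (Slist-enumerates n m _) (Slist-enumerates n m ν)
                       (precompose-bijection n m π ν) (term-cong ν) ⟩
    sumList (Slist n m ν) (term n ν) ∎

  u-drop-last : ∀ {n m} → m ≤ n → (ν : Fin (suc n) → ℕ) → ν (fromℕ n) ≡ 0 →
    u R ζ (suc n) m ν ≈ (suc n ∸ ℓ (suc n) ν) · u R ζ n m (ν ∘ inject₁)
  u-drop-last {n} {m} m≤n ν ν-last = begin
    sumList (Slist (suc n) m ν) (term (suc n) ν)
      ≈⟨ sum-bijection Pairs (Funs (suc n) (suc n)) Admissible-enumerates (Slist-enumerates (suc n) m ν)
                       glue-bijection (term-cong ν) ⟨
    sumList (cartesianProduct (Slist n m ν′) Zeros) (term (suc n) ν ∘ glue)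
      ≈⟨ sum-congᴬ (All.map (λ adm → ≈-reflexive (cong (ζ ^_) (glue-expo adm)))
                            (Enumeration.sound Admissible-enumerates)) ⟩
    sumList (cartesianProduct (Slist n m ν′) Zeros) (term n ν′ ∘ proj₁)
      ≈⟨ sum-cartesianProduct-proj₁ (term n ν′) (Slist n m ν′) Zeros ⟩
    length Zeros · u R ζ n m ν′
      ≡⟨ cong (_· u R ζ n m ν′) Zeros-length ⟩
    (suc n ∸ ℓ (suc n) ν) · u R ζ n m ν′ ∎
    where open DropLast m≤n ν ν-last

  u-reduce : ∀ {m n} (m≤′n : m ≤′ n) (ν : Fin n → ℕ) → (∀ i → m ≤ toℕ i → ν i ≡ 0) →
    u R ζ n m ν ≈ factorialRatio (n ∸ ℓ n ν) (m ∸ ℓ n ν) · u R ζ m m (λ j → ν (inject≤ j (≤′⇒≤ m≤′n)))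
  u-reduce {m} ≤′-refl ν _ = begin
    u R ζ m m ν                  ≈⟨ u-cong m m (λ j → cong ν (sym (inject≤-refl j _))) ⟩
    u R ζ m m ν↾                 ≈⟨ ×-homo-1 (u R ζ m m ν↾) ⟨
    1 · u R ζ m m ν↾             ≡⟨ cong (_· u R ζ m m ν↾) (sym (factorialRatio-refl (m ∸ ℓ m ν))) ⟩
    factorialRatio (m ∸ ℓ m ν) (m ∸ ℓ m ν) · u R ζ m m ν↾ ∎
    where
    ν↾ : Fin m → ℕ
    ν↾ j = ν (inject≤ j (≤′⇒≤ (≤′-refl {m})))
  u-reduce {m} {suc n} (≤′-step m≤′n) ν vanish = begin
    u R ζ (suc n) m ν
      ≈⟨ u-drop-last m≤n ν ν-last ⟩
    (suc n ∸ ℓ (suc n) ν) · u R ζ n m ν′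
      ≡⟨ cong (λ k → (suc n ∸ k) · u R ζ n m ν′) ℓ-eq ⟩
    (suc n ∸ L) · u R ζ n m ν′
      ≈⟨ ×-congʳ (suc n ∸ L) (u-reduce m≤′n ν′ vanish′) ⟩
    (suc n ∸ L) · (factorialRatio (n ∸ L) (m ∸ L) · u R ζ m m ν′↾)
      ≈⟨ ×-assocˡ _ (suc n ∸ L) _ ⟩
    ((suc n ∸ L) * factorialRatio (n ∸ L) (m ∸ L)) · u R ζ m m ν′↾
      ≡⟨ cong (_· u R ζ m m ν′↾) (factorialRatio-∸ (ℓ-bound n ν′) m≤n) ⟩
    factorialRatio (suc n ∸ L) (m ∸ L) · u R ζ m m ν′↾
      ≈⟨ ×-congʳ (factorialRatio (suc n ∸ L) (m ∸ L)) (u-cong m m same-parts) ⟩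
    factorialRatio (suc n ∸ L) (m ∸ L) · u R ζ m m ν↾
      ≡⟨ cong (λ k → factorialRatio (suc n ∸ k) (m ∸ k) · u R ζ m m ν↾) ℓ-eq ⟨
    factorialRatio (suc n ∸ ℓ (suc n) ν) (m ∸ ℓ (suc n) ν) · u R ζ m m ν↾ ∎
    where
    m≤n : m ≤ n
    m≤n = ≤′⇒≤ m≤′n
    ν′ : Fin n → ℕ
    ν′ = ν ∘ inject₁
    ν′↾ ν↾ : Fin m → ℕ
    ν′↾ j = ν′ (inject≤ j m≤n)
    ν↾ j = ν (inject≤ j (≤′⇒≤ (≤′-step m≤′n)))
    ν-last : ν (fromℕ n) ≡ 0
    ν-last = vanish (fromℕ n) (subst (m ≤_) (sym (toℕ-fromℕ n)) m≤n)
    vanish′ : ∀ i → m ≤ toℕ i → ν′ i ≡ 0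
    vanish′ i m≤i = vanish (inject₁ i) (subst (m ≤_) (sym (toℕ-inject₁ i)) m≤i)
    L : ℕ
    L = ℓ n ν′
    ℓ-eq : ℓ (suc n) ν ≡ L
    ℓ-eq = ℓ-drop-last n ν ν-last
    same-parts : ν′↾ ≗ ν↾
    same-parts j =
      cong ν (toℕ-injective (trans (toℕ-inject₁ _) (trans (toℕ-inject≤ j _) (sym (toℕ-inject≤ j _)))))

-- Lemma 2.3.  Both parts hold for every ζ and every ν.  The factor (n - ℓ)!/(m - ℓ)! is factorialRatio, and m ≤ n is
-- turned into the inductive m ≤′ n (the proof argument of inject≤ is irrelevant).
lemma2p3 : ∀ {c ℓ' : Level} (R : CommutativeRing c ℓ') (n m : ℕ) → 1 ≤ n → 1 ≤ m →
    (ζ : CommutativeRing.Carrier R) → IsPrimitiveRoot R m ζ →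
      ((π : Permutation′ n) (ν : Fin n → ℕ) → InP n m ν →
        CommutativeRing._≈_ R (u R ζ n m (λ i → ν (π ⟨$⟩ʳ i))) (u R ζ n m ν))
    × ((m≤n : m ≤ n) (ν : Fin n → ℕ) → InP n m ν → (∀ i → m ≤ toℕ i → ν i ≡ 0) →
        CommutativeRing._≈_ R (u R ζ n m ν)
          (nsmul R
            (_/_ ((n ∸ ℓ n ν) !) ((m ∸ ℓ n ν) !) {{(m ∸ ℓ n ν) !≢0}})
            (u R ζ m m (λ j → ν (inject≤ j m≤n)))))
lemma2p3 R n m _ _ ζ _ =
  (λ π ν _ → u-symmetric n m π ν) ,
  (λ m≤n ν _ vanish → u-reduce (≤⇒≤′ m≤n) ν vanish)
  where open USums R ζ
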